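{- There do not exist edge-regular graphs $G_1$ and $G_2$ such that the tensor product $G_1\otimes G_2$ is a strongly regular graph with parameters $(99,14,1,2)$ (Conway's 99-graph). That is, if Conway's 99-graph exists, it cannot be constructed as the tensor product of edge-regular graphs.
   Context: A graph is edge-regular, $G\in ER(n,d,\lambda)$, if it has $n$ vertices, is regular of degree $d$, and every pair of adjacent vertices has exactly $\lambda$ common neighbors. A strongly regular graph with parameters $(n,d,\lambda,\mu)$ is a graph in $ER(n,d,\lambda)$ in which every pair of distinct non-adjacent vertices has exactly $\mu$ common neighbors. The tensor product $G_1\otimes G_2$ has vertex set $V(G_1)\times V(G_2)$, with $(u,u')\sim(v,v')$ iff $u\sim v$ in $G_1$ and $u'\sim v'$ in $G_2$. -}

module Defs where

open import Data.Nat using (ℕ; _*_)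
open import Data.Bool using (Bool; true; false; _∧_)
open import Data.Fin using (Fin; remQuot)
open import Data.List using (List; filter; length)
open import Data.List using () renaming (allFin to allFinL)
open import Data.Product using (proj₁; proj₂)
open import Relation.Binary.PropositionalEquality using (_≡_; _≢_)
open import Data.Bool.Properties using (T?)
open import Data.Bool using (T)

record Graph (n : ℕ) : Set where
  field
    adj     : Fin n → Fin n → Bool
    sym     : ∀ u v → adj u v ≡ adj v u
    irrefl  : ∀ u → adj u u ≡ false
open Graph public

_∼[_]_ : {n : ℕ} → Fin n → Graph n → Fin n → Set
u ∼[ G ] v = T (adj G u v)

degree : {n : ℕ} → Graph n → Fin n → ℕ
degree {n} G u = length (filter (λ w → T? (adj G u w)) (allFinL n))

common : {n : ℕ} → Graph n → Fin n → Fin n → ℕ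
common {n} G u v = length (filter (λ w → T? (adj G u w ∧ adj G v w)) (allFinL n))

IsEdgeRegular : {n : ℕ} → Graph n → ℕ → ℕ → Set
IsEdgeRegular G d l =
  (∀ u → degree G u ≡ d) × (∀ u v → u ∼[ G ] v → common G u v ≡ l)
  where open import Data.Product using (_×_)

IsSRG : {n : ℕ} → Graph n → ℕ → ℕ → ℕ → ℕ → Set
IsSRG {n} G N d l m =
  n ≡ N × IsEdgeRegular G d l ×
  (∀ u v → u ≢ v → ¬ (u ∼[ G ] v) → common G u v ≡ m)
  where open import Data.Product using (_×_)
        open import Relation.Nullary using (¬_)

-- tensor product; vertex (i , j) is encoded as combine i j, decoded by remQuot
tensor : {m n : ℕ} → Graph m → Graph n → Graph (m * n)
tensor {m} {n} G H = record
  { adj    = λ x y → adj G (p x) (p y) ∧ adj H (q x) (q y)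
  ; sym    = λ x y → cong₂ _∧_ (sym G (p x) (p y)) (sym H (q x) (q y))
  ; irrefl = λ x → cong (_∧ adj H (q x) (q x)) (irrefl G (p x))
  }
  where
    open import Relation.Binary.PropositionalEquality using (cong; cong₂)
    p : Fin (m * n) → Fin m
    p x = proj₁ (remQuot {m} n x)
    q : Fin (m * n) → Fin n
    q x = proj₂ (remQuot {m} n x)

{-# OPTIONS --safe #-}
-- Degrees and common-neighbour counts multiply under the tensor product, so
-- d₁ d₂ = 14 and λ₁ λ₂ = 1, whence λ₁ = λ₂ = 1.  In an edge-regular graph d λ is
-- twice the number of edges inside a neighbourhood, so d₁ and d₂ are both even
-- and 4 would divide 14.
module Submission where

open import Defs hiding (sym)
open import Data.Nat using (ℕ; zero; suc; _+_; _*_)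
open import Relation.Nullary using (¬_)

open import Algebra.Bundles using (CommutativeMonoid)
open import Data.Bool using (Bool; true; false; _∧_; T)
open import Data.Bool.Properties using (T?; T-≡; T-∧; ∧-zeroʳ; ∧-commutativeMonoid)
open import Data.Fin using (Fin; zero; suc; _↑ˡ_; _↑ʳ_; combine; remQuot)
open import Data.Fin.Properties using (remQuot-combine)
open import Data.List using (filter; length; tabulate)
open import Data.Nat.Divisibility using (_∣_; _∣?_; divides; m∣m*n; ∣m∣n⇒∣m+n; *-pres-∣)
open import Data.Nat.Properties
  using (+-*-semiring; +-assoc; +-identityʳ; *-identityʳ; m*n≡1⇒m≡1; m*n≡1⇒n≡1)
open import Data.Product using (∃; _,_; proj₁; proj₂; uncurry)
open import Function using (_∘_; Equivalence)
open import Relation.Binary.PropositionalEquality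
  using (_≡_; refl; sym; trans; cong; cong₂; subst; module ≡-Reasoning)
open import Relation.Nullary.Decidable using (from-no)

open import Algebra.Properties.Semiring.Sum +-*-semiring
  using (sum; sum-syntax; sum-cong-≗; ∑-distrib-+; *-distribˡ-sum; *-distribʳ-sum)
open import Algebra.Properties.CommutativeSemigroup
  (CommutativeMonoid.commutativeSemigroup ∧-commutativeMonoid)
  using (interchange; x∙yz≈y∙xz)

open Equivalence using (to; from)

indicator : Bool → ℕ
indicator true  = 1
indicator false = 0

indicator-∧ : ∀ a b → indicator (a ∧ b) ≡ indicator a * indicator b
indicator-∧ true  b = sym (+-identityʳ (indicator b))
indicator-∧ false b = refl

count : ∀ {k} → (Fin k → Bool) → ℕ
count {k} P = ∑[ i < k ] indicator (P i)

count-cong : ∀ {k} {P Q : Fin k → Bool} → (∀ i → P i ≡ Q i) → count P ≡ count Q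
count-cong P≗Q = sum-cong-≗ (cong indicator ∘ P≗Q)

count-∧ˡ : ∀ {k} b (P : Fin k → Bool) → count (λ i → b ∧ P i) ≡ indicator b * count P
count-∧ˡ b P = trans (sum-cong-≗ (λ i → indicator-∧ b (P i)))
                     (sym (*-distribˡ-sum (indicator b) (indicator ∘ P)))

count≡suc⇒∃ : ∀ {k c} (P : Fin k → Bool) → count P ≡ suc c → ∃ λ i → T (P i)
count≡suc⇒∃ {suc k} P eq with P zero in P0
... | true  = zero , from T-≡ P0
... | false = let i , Pi = count≡suc⇒∃ (P ∘ suc) eq in suc i , Pi

length-filter-tabulate : ∀ {k n} (P : Fin n → Bool) (g : Fin k → Fin n) →
  length (filter (T? ∘ P) (tabulate g)) ≡ count (P ∘ g)
length-filter-tabulate {zero}  P g = refl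
length-filter-tabulate {suc k} P g with P (g zero)
... | true  = cong suc (length-filter-tabulate P (g ∘ suc))
... | false = length-filter-tabulate P (g ∘ suc)

degree≡count : ∀ {n} (G : Graph n) u → degree G u ≡ count (adj G u)
degree≡count G u = length-filter-tabulate (adj G u) (λ w → w)

common≡count : ∀ {n} (G : Graph n) u v → common G u v ≡ count (λ w → adj G u w ∧ adj G v w)
common≡count G u v = length-filter-tabulate (λ w → adj G u w ∧ adj G v w) (λ w → w)

degree≡suc⇒∃-neighbour : ∀ {n c} (G : Graph n) u → degree G u ≡ suc c → ∃ λ v → u ∼[ G ] v
degree≡suc⇒∃-neighbour G u eq = count≡suc⇒∃ (adj G u) (trans (sym (degree≡count G u)) eq)

sum-↑ : ∀ m {n} (f : Fin (m + n) → ℕ) →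
  sum f ≡ ∑[ i < m ] f (i ↑ˡ n) + ∑[ j < n ] f (m ↑ʳ j)
sum-↑ zero    f = refl
sum-↑ (suc m) f = trans (cong (f zero +_) (sum-↑ m (f ∘ suc))) (sym (+-assoc (f zero) _ _))

sum-combine : ∀ m {n} (f : Fin (m * n) → ℕ) → sum f ≡ ∑[ i < m ] ∑[ j < n ] f (combine i j)
sum-combine zero        f = refl
sum-combine (suc m) {n} f = trans (sum-↑ n f)
  (cong (∑[ j < n ] f (j ↑ˡ (m * n)) +_) (sum-combine m (f ∘ (n ↑ʳ_))))

sum-remQuot : ∀ m {n} (g : Fin m → Fin n → ℕ) →
  ∑[ x < m * n ] uncurry g (remQuot n x) ≡ ∑[ i < m ] ∑[ j < n ] g i j
sum-remQuot m {n} g = trans (sum-combine m _)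
  (sum-cong-≗ λ i → sum-cong-≗ λ j → cong (uncurry g) (remQuot-combine i j))

count-remQuot : ∀ m {n} (a : Fin m → Bool) (b : Fin n → Bool) →
  count (λ x → a (proj₁ (remQuot {m} n x)) ∧ b (proj₂ (remQuot {m} n x))) ≡ count a * count b
count-remQuot m {n} a b = begin
  count (λ x → a (proj₁ (remQuot {m} n x)) ∧ b (proj₂ (remQuot {m} n x)))
    ≡⟨ sum-remQuot m (λ i j → indicator (a i ∧ b j)) ⟩
  ∑[ i < m ] count (λ j → a i ∧ b j)       ≡⟨ sum-cong-≗ (λ i → count-∧ˡ (a i) b) ⟩
  ∑[ i < m ] (indicator (a i) * count b)   ≡⟨ *-distribʳ-sum (count b) (indicator ∘ a) ⟨
  count a * count b                        ∎
  where open ≡-Reasoning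

module _ {m n} (G : Graph m) (H : Graph n) where

  private
    p : Fin (m * n) → Fin m
    p x = proj₁ (remQuot {m} n x)
    q : Fin (m * n) → Fin n
    q x = proj₂ (remQuot {m} n x)

  degree-tensor : ∀ x → degree (tensor G H) x ≡ degree G (p x) * degree H (q x)
  degree-tensor x = begin
    degree (tensor G H) x                      ≡⟨ degree≡count (tensor G H) x ⟩
    count (adj (tensor G H) x)                 ≡⟨ count-remQuot m (adj G (p x)) (adj H (q x)) ⟩
    count (adj G (p x)) * count (adj H (q x))  ≡⟨ cong₂ _*_ (degree≡count G (p x)) (degree≡count H (q x)) ⟨
    degree G (p x) * degree H (q x)            ∎
    where open ≡-Reasoning

  common-tensor : ∀ x y → common (tensor G H) x y ≡ common G (p x) (p y) * common H (q x) (q y)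
  common-tensor x y = begin
    common (tensor G H) x y
      ≡⟨ common≡count (tensor G H) x y ⟩
    count (λ w → adj (tensor G H) x w ∧ adj (tensor G H) y w)
      ≡⟨ count-cong (λ w → interchange (adj G (p x) (p w)) _ _ _) ⟩
    count (λ w → (adj G (p x) (p w) ∧ adj G (p y) (p w)) ∧ (adj H (q x) (q w) ∧ adj H (q y) (q w)))
      ≡⟨ count-remQuot m _ _ ⟩
    count (λ w → adj G (p x) w ∧ adj G (p y) w) * count (λ w → adj H (q x) w ∧ adj H (q y) w)
      ≡⟨ cong₂ _*_ (common≡count G (p x) (p y)) (common≡count H (q x) (q y)) ⟨
    common G (p x) (p y) * common H (q x) (q y)
      ∎
    where open ≡-Reasoning

  tensor-isEdgeRegular : ∀ {d₁ d₂ λ₁ λ₂} → IsEdgeRegular G d₁ λ₁ → IsEdgeRegular H d₂ λ₂ →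
    IsEdgeRegular (tensor G H) (d₁ * d₂) (λ₁ * λ₂)
  tensor-isEdgeRegular (degG , comG) (degH , comH) =
      (λ x → trans (degree-tensor x) (cong₂ _*_ (degG (p x)) (degH (q x))))
    , λ x y x∼y → let xy₁ , xy₂ = to T-∧ x∼y in
        trans (common-tensor x y) (cong₂ _*_ (comG _ _ xy₁) (comH _ _ xy₂))

-- Peel off the first row and column; by symmetry they contribute the same amount.
2∣sum-symmetric : ∀ {k} (B : Fin k → Fin k → ℕ) → (∀ i j → B i j ≡ B j i) → (∀ i → B i i ≡ 0) →
  2 ∣ ∑[ i < k ] ∑[ j < k ] B i j
2∣sum-symmetric {zero}  B symm diag = divides 0 refl
2∣sum-symmetric {suc k} B symm diag =
  subst (2 ∣_) (sym sum≡) (subst (2 ∣_) (+-assoc R R S) (∣m∣n⇒∣m+n 2∣R+R 2∣S))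
  where
    open ≡-Reasoning
    R = ∑[ j < k ] B zero (suc j)
    S = ∑[ i < k ] ∑[ j < k ] B (suc i) (suc j)
    2∣R+R : 2 ∣ R + R
    2∣R+R = subst (2 ∣_) (cong (R +_) (+-identityʳ R)) (m∣m*n R)
    2∣S : 2 ∣ S
    2∣S = 2∣sum-symmetric (λ i j → B (suc i) (suc j)) (λ i j → symm (suc i) (suc j)) (diag ∘ suc)
    sum≡ : ∑[ i < suc k ] ∑[ j < suc k ] B i j ≡ R + (R + S)
    sum≡ = begin
      B zero zero + R + ∑[ i < k ] (B (suc i) zero + ∑[ j < k ] B (suc i) (suc j))
        ≡⟨ cong₂ (λ b s → b + R + s) (diag zero) (∑-distrib-+ (λ i → B (suc i) zero) _) ⟩
      R + (∑[ i < k ] B (suc i) zero + S)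
        ≡⟨ cong (λ s → R + (s + S)) (sum-cong-≗ (λ i → symm (suc i) zero)) ⟩
      R + (R + S) ∎

2∣degree*lambda : ∀ {n d l} (G : Graph n) → IsEdgeRegular G d l → Fin n → 2 ∣ d * l
2∣degree*lambda {n} {d} {l} G (deg , com) u = subst (2 ∣_) total
  (2∣sum-symmetric (λ v w → indicator (N v w)) symm (λ v → cong indicator (diag v)))
  where
    open ≡-Reasoning
    N : Fin n → Fin n → Bool
    N v w = adj G u v ∧ adj G u w ∧ adj G v w
    symm : ∀ v w → indicator (N v w) ≡ indicator (N w v)
    symm v w = cong indicator (trans (x∙yz≈y∙xz (adj G u v) (adj G u w) (adj G v w))
                                     (cong (λ b → adj G u w ∧ adj G u v ∧ b) (Graph.sym G v w)))
    diag : ∀ v → N v v ≡ false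
    diag v rewrite irrefl G v | ∧-zeroʳ (adj G u v) = ∧-zeroʳ (adj G u v)
    row : ∀ v → indicator (adj G u v) * common G u v ≡ indicator (adj G u v) * l
    row v with adj G u v in uv
    ... | true  = cong (1 *_) (com u v (from T-≡ uv))
    ... | false = refl
    total : ∑[ v < n ] ∑[ w < n ] indicator (N v w) ≡ d * l
    total = begin
      ∑[ v < n ] count (λ w → adj G u v ∧ adj G u w ∧ adj G v w)
        ≡⟨ sum-cong-≗ (λ v → trans (count-∧ˡ (adj G u v) (λ w → adj G u w ∧ adj G v w))
                                   (cong (indicator (adj G u v) *_) (sym (common≡count G u v)))) ⟩
      ∑[ v < n ] (indicator (adj G u v) * common G u v)   ≡⟨ sum-cong-≗ row ⟩
      ∑[ v < n ] (indicator (adj G u v) * l)              ≡⟨ *-distribʳ-sum l (indicator ∘ adj G u) ⟨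
      count (adj G u) * l                                ≡⟨ cong (_* l) (trans (sym (degree≡count G u)) (deg u)) ⟩
      d * l                                              ∎

2∣degree : ∀ {n d} (G : Graph n) → IsEdgeRegular G d 1 → Fin n → 2 ∣ d
2∣degree {d = d} G er u = subst (2 ∣_) (*-identityʳ d) (2∣degree*lambda G er u)

theorem12 : ∀ {n₁ n₂ d₁ d₂ λ₁ λ₂ : ℕ} (G₁ : Graph n₁) (G₂ : Graph n₂)
    → IsEdgeRegular G₁ d₁ λ₁ → IsEdgeRegular G₂ d₂ λ₂
    → ¬ IsSRG (tensor G₁ G₂) 99 14 1 2
theorem12 {n₁} {n₂} {d₁} {d₂} {λ₁} {λ₂} G₁ G₂ er₁ er₂ (n≡99 , (deg , com) , _) =
  from-no (4 ∣? 14) (subst (4 ∣_) d₁d₂≡14 (*-pres-∣ 2∣d₁ 2∣d₂))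
  where
    er = tensor-isEdgeRegular G₁ G₂ er₁ er₂
    x = subst Fin (sym n≡99) zero
    d₁d₂≡14 : d₁ * d₂ ≡ 14
    d₁d₂≡14 = trans (sym (proj₁ er x)) (deg x)
    λ₁λ₂≡1 : λ₁ * λ₂ ≡ 1
    λ₁λ₂≡1 = let y , x∼y = degree≡suc⇒∃-neighbour (tensor G₁ G₂) x (deg x)
             in trans (sym (proj₂ er x y x∼y)) (com x y x∼y)
    2∣d₁ : 2 ∣ d₁
    2∣d₁ = 2∣degree G₁ (subst (IsEdgeRegular G₁ d₁) (m*n≡1⇒m≡1 λ₁ λ₂ λ₁λ₂≡1) er₁)
                       (proj₁ (remQuot {n₁} n₂ x))
    2∣d₂ : 2 ∣ d₂
    2∣d₂ = 2∣degree G₂ (subst (IsEdgeRegular G₂ d₂) (m*n≡1⇒n≡1 λ₁ λ₂ λ₁λ₂≡1) er₂)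
                       (proj₂ (remQuot {n₁} n₂ x))
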